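{- Let $G$ be a $12$-representable labeled graph. Then every bad vertex of $G$ occurs (at least) twice in every $12$-representant of $G$.
   Context: A labeled graph on $n$ vertices has its vertices labeled by distinct integers from $[n]=\{1,\dots,n\}$; vertices are identified with their labels. A word $w$ over $[n]$ is a $12$-representant of $G$ if every letter of $[n]$ occurs at least once in $w$ and, for all $i<j$, the vertices $i$ and $j$ are adjacent in $G$ if and only if there is no occurrence of $i$ in $w$ that precedes an occurrence of $j$; $G$ is $12$-representable if such a word exists. A vertex $b$ of $G$ is bad if there exist vertices $a,c$ with $a<b<c$ such that $ab\notin E(G)$, $bc\notin E(G)$ and $ac\in E(G)$; otherwise it is good. -}

module Defs where

open import Data.Nat using (ℕ; _<_)
open import Data.Fin using (Fin) renaming (_<_ to _<ᶠ_)
open import Data.List using (List; length; lookup)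
open import Data.List.Membership.Propositional using (_∈_)
open import Data.Product using (Σ; _×_; ∃; ∃-syntax; _,_)
open import Relation.Binary.PropositionalEquality using (_≡_)
open import Relation.Nullary using (¬_)

-- A labeled (simple, undirected, loopless) graph on vertex set [n],
-- with vertex labels 1..n encoded as Fin n (0..n-1), order preserved.
record Graph (n : ℕ) : Set₁ where
  field
    Adj     : Fin n → Fin n → Set
    sym     : ∀ {i j} → Adj i j → Adj j i
    irrefl  : ∀ {i} → ¬ Adj i i
open Graph public

Word : ℕ → Set
Word n = List (Fin n)

Precedes : ∀ {n} → Word n → Fin n → Fin n → Set
Precedes w i j =
  ∃[ p ] ∃[ q ] (p <ᶠ q × lookup w p ≡ i × lookup w q ≡ j)

Is12Representant : ∀ {n} → Graph n → Word n → Set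
Is12Representant {n} G w =
  (∀ (v : Fin n) → v ∈ w) ×
  (∀ (i j : Fin n) → i <ᶠ j → (Adj G i j → ¬ Precedes w i j) × (¬ Precedes w i j → Adj G i j))

Is12Representable : ∀ {n} → Graph n → Set
Is12Representable {n} G = ∃[ w ] Is12Representant G w

Bad : ∀ {n} → Graph n → Fin n → Set
Bad {n} G b = ∃[ a ] ∃[ c ]
  (a <ᶠ b × b <ᶠ c × ¬ Adj G a b × ¬ Adj G b c × Adj G a c)

OccursTwice : ∀ {n} → Word n → Fin n → Set
OccursTwice w v = ∃[ p ] ∃[ q ] (p <ᶠ q × lookup w p ≡ v × lookup w q ≡ v)

-- If b occurred once in a 12-representant w, then ab ∉ E and bc ∉ E force some a
-- before that b and some c after it, so a precedes c in w, contradicting ac ∈ E.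
module Submission where

open import Defs
open import Data.Nat using (ℕ)
open import Data.Fin using (Fin; _<?_; _≟_) renaming (_<_ to _<ᶠ_)
open import Data.Fin.Properties using (any?; <-cmp; <-trans)
open import Data.List using (lookup)
open import Data.Product using (_,_; proj₁; proj₂)
open import Data.Empty using (⊥-elim)
open import Data.Sum using (_⊎_; inj₁; inj₂)
open import Relation.Nullary using (Dec; ¬_)
open import Relation.Nullary.Decidable using (_×-dec_; decidable-stable)
open import Relation.Binary.Definitions using (tri<; tri≈; tri>)
open import Relation.Binary.PropositionalEquality using (refl)

precedes? : ∀ {n} (w : Word n) (i j : Fin n) → Dec (Precedes w i j)
precedes? w i j =
  any? λ p → any? λ q → (p <? q) ×-dec ((lookup w p ≟ i) ×-dec (lookup w q ≟ j))

precedes-trans⊎occursTwice : ∀ {n} (w : Word n) {a b c : Fin n} →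
  Precedes w a b → Precedes w b c → Precedes w a c ⊎ OccursTwice w b
precedes-trans⊎occursTwice w (pa , pb , pa<pb , wa , wb) (pb′ , pc , pb′<pc , wb′ , wc)
  with <-cmp pb pb′
... | tri< pb<pb′ _ _ = inj₂ (pb , pb′ , pb<pb′ , wb , wb′)
... | tri≈ _ refl _   = inj₁ (pa , pc , <-trans pa<pb pb′<pc , wa , wc)
... | tri> _ _ pb′<pb = inj₂ (pb′ , pb , pb′<pb , wb′ , wb)

module _ {n} (G : Graph n) {w : Word n} (rep : Is12Representant G w) where

  adjacent⇒¬precedes : ∀ {i j} → i <ᶠ j → Adj G i j → ¬ Precedes w i j
  adjacent⇒¬precedes {i} {j} i<j = proj₁ (proj₂ rep i j i<j)

  nonadjacent⇒precedes : ∀ {i j} → i <ᶠ j → ¬ Adj G i j → Precedes w i j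
  nonadjacent⇒precedes {i} {j} i<j ¬ij =
    decidable-stable (precedes? w i j) (λ ¬prec → ¬ij (proj₂ (proj₂ rep i j i<j) ¬prec))

proposition3p2 : ∀ (n : ℕ) (G : Graph n) → Is12Representable G →
    ∀ (b : Fin n) → Bad G b → ∀ (w : Word n) → Is12Representant G w → OccursTwice w b
proposition3p2 n G _ b (a , c , a<b , b<c , ¬ab , ¬bc , ac) w rep
  with precedes-trans⊎occursTwice w (nonadjacent⇒precedes G rep a<b ¬ab)
                                    (nonadjacent⇒precedes G rep b<c ¬bc)
... | inj₁ a-before-c = ⊥-elim (adjacent⇒¬precedes G rep (<-trans a<b b<c) ac a-before-c)
... | inj₂ twice      = twice
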